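{- Let $A$ be a unital power-associative algebra over a field $F$ (i.e. every one-generated subalgebra of $A$ is associative), with unit $1$, and let $R\colon A\to A$ be a Rota---Baxter operator of weight $-1$ on $A$. Put $\phi(R)=\mathrm{id}-R$, $a=R(1)$ and $b=\phi(R)(1)=1-a$. Then for every positive integer $n$, $$R(a^n)-a^n=(-1)^{n+1}\big(\phi(R)(b^n)-b^n\big).$$
   Context: An algebra means a vector space with a bilinear, not necessarily associative, product. A linear operator $R\colon A\to A$ is a Rota---Baxter operator of weight $\lambda\in F$ if $R(x)R(y)=R\big(R(x)y+xR(y)+\lambda xy\big)$ for all $x,y\in A$. For a Rota---Baxter operator $P$ of weight $\lambda$, $\phi(P)$ denotes $-P-\lambda\,\mathrm{id}$; for $\lambda=-1$ this is $\mathrm{id}-P$. -}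

module Defs where

open import Level using (Level; _⊔_) renaming (suc to lsuc)
open import Data.Nat using (ℕ; zero; suc)
open import Data.Product using (∃)
open import Relation.Nullary using (¬_)
open import Algebra.Bundles using (CommutativeRing)
open import Algebra.Module.Bundles using (LeftModule)

record Field (c ℓ : Level) : Set (lsuc (c ⊔ ℓ)) where
  field
    commutativeRing : CommutativeRing c ℓ
  open CommutativeRing commutativeRing public
  field
    0≉1     : ¬ (0# ≈ 1#)
    inverse : ∀ x → ¬ (x ≈ 0#) → ∃ λ y → x * y ≈ 1#

record UnitalAlgebra {c ℓ : Level} (F : Field c ℓ) (m ℓm : Level)
       : Set (c ⊔ ℓ ⊔ lsuc (m ⊔ ℓm)) where
  open Field F using (ring; _*_)
  field
    vectorSpace : LeftModule ring m ℓm
  open LeftModule vectorSpace public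
  infixl 8 _·_
  field
    _·_     : Carrierᴹ → Carrierᴹ → Carrierᴹ
    𝟙       : Carrierᴹ
    ·-cong  : ∀ {x x′ y y′} → x ≈ᴹ x′ → y ≈ᴹ y′ → x · y ≈ᴹ x′ · y′
    ·-distribʳ : ∀ x y z → (x +ᴹ y) · z ≈ᴹ x · z +ᴹ y · z
    ·-distribˡ : ∀ x y z → x · (y +ᴹ z) ≈ᴹ x · y +ᴹ x · z
    ·-scalarˡ  : ∀ (α : Field.Carrier F) x y → (α *ₗ x) · y ≈ᴹ α *ₗ (x · y)
    ·-scalarʳ  : ∀ (α : Field.Carrier F) x y → x · (α *ₗ y) ≈ᴹ α *ₗ (x · y)
    ·-identityˡ : ∀ x → 𝟙 · x ≈ᴹ x
    ·-identityʳ : ∀ x → x · 𝟙 ≈ᴹ x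

module _ {c ℓ m ℓm : Level} {F : Field c ℓ} (A : UnitalAlgebra F m ℓm) where
  open UnitalAlgebra A

  -- Nonassociative monomials in one generator (binary trees with leaves x).
  data Monomial : Set where
    gen  : Monomial
    _⊗_  : Monomial → Monomial → Monomial

  evalMon : Carrierᴹ → Monomial → Carrierᴹ
  evalMon x gen     = x
  evalMon x (p ⊗ q) = evalMon x p · evalMon x q

  -- Power-associativity: the subalgebra generated by x (the linear span of
  -- all nonassociative monomials in x) is associative; by bilinearity this is
  -- associativity on the spanning monomials.
  PowerAssociative : Set (m ⊔ ℓm)
  PowerAssociative = ∀ x (p q r : Monomial) →
    (evalMon x p · evalMon x q) · evalMon x r ≈ᴹ
      evalMon x p · (evalMon x q · evalMon x r)

  record LinearOperator : Set (c ⊔ m ⊔ ℓm) where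
    field
      ap     : Carrierᴹ → Carrierᴹ
      cong   : ∀ {x y} → x ≈ᴹ y → ap x ≈ᴹ ap y
      additive : ∀ x y → ap (x +ᴹ y) ≈ᴹ ap x +ᴹ ap y
      homogeneous : ∀ (α : Field.Carrier F) x → ap (α *ₗ x) ≈ᴹ α *ₗ ap x

  IsRotaBaxter : Field.Carrier F → LinearOperator → Set (m ⊔ ℓm)
  IsRotaBaxter λ′ R = ∀ x y →
    ap x · ap y ≈ᴹ ap (ap x · y +ᴹ x · ap y +ᴹ λ′ *ₗ (x · y))
    where open LinearOperator R

  φ : Field.Carrier F → LinearOperator → Carrierᴹ → Carrierᴹ
  φ λ′ P x = -ᴹ LinearOperator.ap P x +ᴹ -ᴹ (λ′ *ₗ x)

  -- Powers x^n (right-normed, x^0 = 1; in a power-associative algebra all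
  -- bracketings of x^n agree).
  pow : Carrierᴹ → ℕ → Carrierᴹ
  pow x zero          = 𝟙
  pow x (suc zero)    = x
  pow x (suc (suc n)) = x · pow x (suc n)

  signed : ℕ → Carrierᴹ → Carrierᴹ
  signed zero    v = v
  signed (suc k) v = -ᴹ signed k v

-- With a = R 1 and c = a - 1 the Rota–Baxter identity of weight -1 gives
-- a · R y = R (a · y + R y - y); feeding in y = a^n - c^n shows by induction
-- that a^n = R (a^n - c^n), i.e. R (a^n) - a^n = R (c^n). Since φ(R) = id - R,
-- b = 1 - a = -c and φ(R)(b^n) - b^n = -R (b^n), so both sides equal (-1)^n R (b^n).
-- Only right-normed powers occur.
{-# OPTIONS --safe #-}
module Submission where

open import Defs
open import Level using (Level)
open import Data.Nat using (ℕ; zero; suc; _+_; _≥_; s≤s)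
open import Algebra.Bundles using (Ring; AbelianGroup)
open import Algebra.Module.Bundles using (LeftModule)
import Algebra.Properties.AbelianGroup as AbelianGroupProperties
import Relation.Binary.Reasoning.Setoid as SetoidReasoning

module _ {g ℓg : Level} (G : AbelianGroup g ℓg) where
  open AbelianGroup G
  open AbelianGroupProperties G using (⁻¹-anti-homo‿-; xyx⁻¹≈y)
  open SetoidReasoning setoid

  x-[x-y]≈y : ∀ x y → x ∙ (x ∙ y ⁻¹) ⁻¹ ≈ y
  x-[x-y]≈y x y = begin
    x ∙ (x ∙ y ⁻¹) ⁻¹  ≈⟨ ∙-congˡ (⁻¹-anti-homo‿- x y) ⟩
    x ∙ (y ∙ x ⁻¹)     ≈⟨ assoc x y (x ⁻¹) ⟨
    x ∙ y ∙ x ⁻¹       ≈⟨ xyx⁻¹≈y x y ⟩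
    y                  ∎

module _ {r ℓr m ℓm : Level} {ring : Ring r ℓr} (M : LeftModule ring m ℓm) where
  open Ring ring using (1#; 0#; -_; -‿inverseʳ) renaming (_+_ to _+ʳ_)
  open LeftModule M
  open AbelianGroupProperties +ᴹ-abelianGroup using (inverseʳ-unique)
  open SetoidReasoning ≈ᴹ-setoid

  -1*ₗx≈-ᴹx : ∀ x → (- 1#) *ₗ x ≈ᴹ -ᴹ x
  -1*ₗx≈-ᴹx x = inverseʳ-unique x ((- 1#) *ₗ x) (begin
    x +ᴹ (- 1#) *ₗ x         ≈⟨ +ᴹ-congʳ (*ₗ-identityˡ x) ⟨
    1# *ₗ x +ᴹ (- 1#) *ₗ x   ≈⟨ *ₗ-distribʳ x 1# (- 1#) ⟨
    (1# +ʳ - 1#) *ₗ x        ≈⟨ *ₗ-congʳ (-‿inverseʳ 1#) ⟩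
    0# *ₗ x                  ≈⟨ *ₗ-zeroˡ x ⟩
    0ᴹ                       ∎)

module _ {f ℓf m ℓm : Level} {F : Field f ℓf} (A : UnitalAlgebra F m ℓm) where
  open Field F using (1#) renaming (-_ to -F_)
  open UnitalAlgebra A
  open AbelianGroupProperties +ᴹ-abelianGroup
    using (⁻¹-anti-homo‿-; xyx⁻¹≈y) renaming (⁻¹-involutive to -ᴹ-involutive)
  open SetoidReasoning ≈ᴹ-setoid

  ·-negˡ : ∀ x y → (-ᴹ x) · y ≈ᴹ -ᴹ (x · y)
  ·-negˡ x y = begin
    (-ᴹ x) · y          ≈⟨ ·-cong (-1*ₗx≈-ᴹx vectorSpace x) ≈ᴹ-refl ⟨
    ((-F 1#) *ₗ x) · y  ≈⟨ ·-scalarˡ (-F 1#) x y ⟩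
    (-F 1#) *ₗ (x · y)  ≈⟨ -1*ₗx≈-ᴹx vectorSpace (x · y) ⟩
    -ᴹ (x · y)          ∎

  ·-negʳ : ∀ x y → x · (-ᴹ y) ≈ᴹ -ᴹ (x · y)
  ·-negʳ x y = begin
    x · (-ᴹ y)          ≈⟨ ·-cong ≈ᴹ-refl (-1*ₗx≈-ᴹx vectorSpace y) ⟨
    x · ((-F 1#) *ₗ y)  ≈⟨ ·-scalarʳ (-F 1#) x y ⟩
    (-F 1#) *ₗ (x · y)  ≈⟨ -1*ₗx≈-ᴹx vectorSpace (x · y) ⟩
    -ᴹ (x · y)          ∎

  [x-𝟙]·y≈x·y-y : ∀ x y → (x +ᴹ -ᴹ 𝟙) · y ≈ᴹ x · y +ᴹ -ᴹ y
  [x-𝟙]·y≈x·y-y x y = begin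
    (x +ᴹ -ᴹ 𝟙) · y       ≈⟨ ·-distribʳ x (-ᴹ 𝟙) y ⟩
    x · y +ᴹ (-ᴹ 𝟙) · y   ≈⟨ +ᴹ-congˡ (·-negˡ 𝟙 y) ⟩
    x · y +ᴹ -ᴹ (𝟙 · y)   ≈⟨ +ᴹ-congˡ (-ᴹ‿cong (·-identityˡ y)) ⟩
    x · y +ᴹ -ᴹ y         ∎

  signed-cong : ∀ k {u v} → u ≈ᴹ v → signed A k u ≈ᴹ signed A k v
  signed-cong zero    u≈v = u≈v
  signed-cong (suc k) u≈v = -ᴹ‿cong (signed-cong k u≈v)

  signed-+1-neg : ∀ k v → signed A (k + 1) (-ᴹ v) ≈ᴹ signed A k v
  signed-+1-neg zero    v = -ᴹ-involutive v
  signed-+1-neg (suc k) v = -ᴹ‿cong (signed-+1-neg k v)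

  signed-homo : ∀ (f : Carrierᴹ → Carrierᴹ) → (∀ v → f (-ᴹ v) ≈ᴹ -ᴹ f v) →
                ∀ k v → f (signed A k v) ≈ᴹ signed A k (f v)
  signed-homo f f-neg zero    v = ≈ᴹ-refl
  signed-homo f f-neg (suc k) v =
    ≈ᴹ-trans (f-neg (signed A k v)) (-ᴹ‿cong (signed-homo f f-neg k v))

  pow-cong : ∀ k {x y} → x ≈ᴹ y → pow A x k ≈ᴹ pow A y k
  pow-cong zero          x≈y = ≈ᴹ-refl
  pow-cong (suc zero)    x≈y = x≈y
  pow-cong (suc (suc k)) x≈y = ·-cong x≈y (pow-cong (suc k) x≈y)

  pow-neg : ∀ k x → pow A (-ᴹ x) k ≈ᴹ signed A k (pow A x k)
  pow-neg zero          x = ≈ᴹ-refl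
  pow-neg (suc zero)    x = ≈ᴹ-refl
  pow-neg (suc (suc k)) x = begin
    (-ᴹ x) · pow A (-ᴹ x) (suc k)                ≈⟨ ·-negˡ x _ ⟩
    -ᴹ (x · pow A (-ᴹ x) (suc k))                ≈⟨ -ᴹ‿cong (·-cong ≈ᴹ-refl (pow-neg (suc k) x)) ⟩
    -ᴹ (x · signed A (suc k) (pow A x (suc k)))  ≈⟨ -ᴹ‿cong (signed-homo (x ·_) (·-negʳ x) (suc k) _) ⟩
    -ᴹ signed A (suc k) (x · pow A x (suc k))    ∎

  module _ (R : LinearOperator A) where
    open LinearOperator R renaming (cong to R-cong)

    R-neg : ∀ x → ap (-ᴹ x) ≈ᴹ -ᴹ ap x
    R-neg x = begin
      ap (-ᴹ x)                ≈⟨ R-cong (-1*ₗx≈-ᴹx vectorSpace x) ⟨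
      ap ((-F 1#) *ₗ x)        ≈⟨ homogeneous (-F 1#) x ⟩
      (-F 1#) *ₗ ap x          ≈⟨ -1*ₗx≈-ᴹx vectorSpace (ap x) ⟩
      -ᴹ ap x                  ∎

    R-sub : ∀ x y → ap (x +ᴹ -ᴹ y) ≈ᴹ ap x +ᴹ -ᴹ ap y
    R-sub x y = ≈ᴹ-trans (additive x (-ᴹ y)) (+ᴹ-congˡ (R-neg y))

    φ₋₁x≈x-Rx : ∀ x → φ A (-F 1#) R x ≈ᴹ x +ᴹ -ᴹ ap x
    φ₋₁x≈x-Rx x = begin
      -ᴹ ap x +ᴹ -ᴹ ((-F 1#) *ₗ x)  ≈⟨ +ᴹ-congˡ (-ᴹ‿cong (-1*ₗx≈-ᴹx vectorSpace x)) ⟩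
      -ᴹ ap x +ᴹ -ᴹ -ᴹ x            ≈⟨ +ᴹ-congˡ (-ᴹ-involutive x) ⟩
      -ᴹ ap x +ᴹ x                  ≈⟨ +ᴹ-comm (-ᴹ ap x) x ⟩
      x +ᴹ -ᴹ ap x                  ∎

    R𝟙-𝟙≈-φ₋₁𝟙 : ap 𝟙 +ᴹ -ᴹ 𝟙 ≈ᴹ -ᴹ φ A (-F 1#) R 𝟙
    R𝟙-𝟙≈-φ₋₁𝟙 = ≈ᴹ-sym (≈ᴹ-trans (-ᴹ‿cong (φ₋₁x≈x-Rx 𝟙)) (⁻¹-anti-homo‿- 𝟙 (ap 𝟙)))

    φ₋₁x-x≈-Rx : ∀ x → φ A (-F 1#) R x +ᴹ -ᴹ x ≈ᴹ -ᴹ ap x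
    φ₋₁x-x≈-Rx x = ≈ᴹ-trans (+ᴹ-congʳ (φ₋₁x≈x-Rx x)) (xyx⁻¹≈y x (-ᴹ ap x))

    module _ (rb : IsRotaBaxter A (-F 1#) R) where
      R𝟙·Ry≈R[R𝟙·y+Ry-y] : ∀ y → ap 𝟙 · ap y ≈ᴹ ap (ap 𝟙 · y +ᴹ (ap y +ᴹ -ᴹ y))
      R𝟙·Ry≈R[R𝟙·y+Ry-y] y = ≈ᴹ-trans (rb 𝟙 y) (R-cong (begin
        ap 𝟙 · y +ᴹ 𝟙 · ap y +ᴹ (-F 1#) *ₗ (𝟙 · y)    ≈⟨ +ᴹ-assoc (ap 𝟙 · y) _ _ ⟩
        ap 𝟙 · y +ᴹ (𝟙 · ap y +ᴹ (-F 1#) *ₗ (𝟙 · y))  ≈⟨ +ᴹ-congˡ (+ᴹ-cong (·-identityˡ (ap y)) -1*ₗ[𝟙·y]≈-ᴹy) ⟩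
        ap 𝟙 · y +ᴹ (ap y +ᴹ -ᴹ y)                    ∎))
        where
        -1*ₗ[𝟙·y]≈-ᴹy : (-F 1#) *ₗ (𝟙 · y) ≈ᴹ -ᴹ y
        -1*ₗ[𝟙·y]≈-ᴹy = ≈ᴹ-trans (-1*ₗx≈-ᴹx vectorSpace (𝟙 · y)) (-ᴹ‿cong (·-identityˡ y))

      a^n≈R[a^n-c^n] : ∀ k → let a = ap 𝟙; c = ap 𝟙 +ᴹ -ᴹ 𝟙 in
                       pow A a (suc k) ≈ᴹ ap (pow A a (suc k) +ᴹ -ᴹ pow A c (suc k))
      a^n≈R[a^n-c^n] zero    = ≈ᴹ-sym (R-cong (x-[x-y]≈y +ᴹ-abelianGroup (ap 𝟙) 𝟙))
      a^n≈R[a^n-c^n] (suc k) = begin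
        a · P                             ≈⟨ ·-cong ≈ᴹ-refl (a^n≈R[a^n-c^n] k) ⟩
        a · ap y                          ≈⟨ R𝟙·Ry≈R[R𝟙·y+Ry-y] y ⟩
        ap (a · y +ᴹ (ap y +ᴹ -ᴹ y))      ≈⟨ R-cong (+ᴹ-cong (·-distribˡ a P (-ᴹ C)) Ry-y≈C) ⟩
        ap (a · P +ᴹ a · (-ᴹ C) +ᴹ C)     ≈⟨ R-cong (+ᴹ-assoc (a · P) _ C) ⟩
        ap (a · P +ᴹ (a · (-ᴹ C) +ᴹ C))   ≈⟨ R-cong (+ᴹ-congˡ (+ᴹ-congʳ (·-negʳ a C))) ⟩
        ap (a · P +ᴹ (-ᴹ (a · C) +ᴹ C))   ≈⟨ R-cong (+ᴹ-congˡ (+ᴹ-comm (-ᴹ (a · C)) C)) ⟩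
        ap (a · P +ᴹ (C +ᴹ -ᴹ (a · C)))   ≈⟨ R-cong (+ᴹ-congˡ (⁻¹-anti-homo‿- (a · C) C)) ⟨
        ap (a · P +ᴹ -ᴹ (a · C +ᴹ -ᴹ C))  ≈⟨ R-cong (+ᴹ-congˡ (-ᴹ‿cong ([x-𝟙]·y≈x·y-y a C))) ⟨
        ap (a · P +ᴹ -ᴹ (c · C))          ∎
        where
        a c P C y : Carrierᴹ
        a = ap 𝟙
        c = a +ᴹ -ᴹ 𝟙
        P = pow A a (suc k)
        C = pow A c (suc k)
        y = P +ᴹ -ᴹ C
        Ry-y≈C : ap y +ᴹ -ᴹ y ≈ᴹ C
        Ry-y≈C = ≈ᴹ-trans (+ᴹ-congʳ (≈ᴹ-sym (a^n≈R[a^n-c^n] k))) (x-[x-y]≈y +ᴹ-abelianGroup P C)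

      R[a^n]-a^n≈R[c^n] : ∀ k → let a = ap 𝟙; c = ap 𝟙 +ᴹ -ᴹ 𝟙 in
                          ap (pow A a (suc k)) +ᴹ -ᴹ pow A a (suc k) ≈ᴹ ap (pow A c (suc k))
      R[a^n]-a^n≈R[c^n] k = begin
        ap P +ᴹ -ᴹ P                    ≈⟨ +ᴹ-congˡ (-ᴹ‿cong (a^n≈R[a^n-c^n] k)) ⟩
        ap P +ᴹ -ᴹ ap (P +ᴹ -ᴹ C)       ≈⟨ +ᴹ-congˡ (-ᴹ‿cong (R-sub P C)) ⟩
        ap P +ᴹ -ᴹ (ap P +ᴹ -ᴹ ap C)    ≈⟨ x-[x-y]≈y +ᴹ-abelianGroup (ap P) (ap C) ⟩
        ap C                            ∎
        where
        P C : Carrierᴹ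
        P = pow A (ap 𝟙) (suc k)
        C = pow A (ap 𝟙 +ᴹ -ᴹ 𝟙) (suc k)

mainTheorem1 : ∀ {c ℓ m ℓm : Level} (F : Field c ℓ) (A : UnitalAlgebra F m ℓm) →
  PowerAssociative A →
  (R : LinearOperator A) →
  IsRotaBaxter A (Field.-_ F (Field.1# F)) R →
  let open UnitalAlgebra A
      Rf = LinearOperator.ap R
      φR = φ A (Field.-_ F (Field.1# F)) R
      a = Rf 𝟙
      b = φR 𝟙
  in (n : ℕ) → n ≥ 1 →
     Rf (pow A a n) +ᴹ -ᴹ pow A a n ≈ᴹ
       signed A (n + 1) (φR (pow A b n) +ᴹ -ᴹ pow A b n)
mainTheorem1 F A _ R rb (suc k) (s≤s _) = begin
  ap (pow A a n) +ᴹ -ᴹ pow A a n                ≈⟨ R[a^n]-a^n≈R[c^n] A R rb k ⟩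
  ap (pow A (a +ᴹ -ᴹ 𝟙) n)                      ≈⟨ R-cong (pow-cong A n (R𝟙-𝟙≈-φ₋₁𝟙 A R)) ⟩
  ap (pow A (-ᴹ b) n)                           ≈⟨ R-cong (pow-neg A n b) ⟩
  ap (signed A n (pow A b n))                   ≈⟨ signed-homo A ap (R-neg A R) n (pow A b n) ⟩
  signed A n (ap (pow A b n))                   ≈⟨ signed-+1-neg A n (ap (pow A b n)) ⟨
  signed A (n + 1) (-ᴹ ap (pow A b n))          ≈⟨ signed-cong A (n + 1) (φ₋₁x-x≈-Rx A R (pow A b n)) ⟨
  signed A (n + 1) (φR (pow A b n) +ᴹ -ᴹ pow A b n) ∎
  where
  open UnitalAlgebra A
  open LinearOperator R renaming (cong to R-cong)
  open SetoidReasoning ≈ᴹ-setoid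
  φR : Carrierᴹ → Carrierᴹ
  φR = φ A (Field.-_ F (Field.1# F)) R
  n : ℕ
  n = suc k
  a b : Carrierᴹ
  a = ap 𝟙
  b = φR 𝟙
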